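{- Let $u_1,\dots,u_r$ be packed words and set $i_k=\max(u_k)$ for $k=1,\dots,r$. Then $$\mathbf M_{u_1}\mathbf M_{u_2}\cdots\mathbf M_{u_r}=(\mathbf M_{u_1}\bullet\mathbf M_{u_2}\bullet\cdots\bullet\mathbf M_{u_r})*\hat S^{(i_1,\dots,i_r)},\qquad\text{where }\hat S^{(i_1,\dots,i_r)}:=\mathbf M_{12\cdots i_1}\mathbf M_{12\cdots i_2}\cdots\mathbf M_{12\cdots i_r}.$$
   Context: A word $u=u_1\cdots u_n$ over the positive integers is packed if its set of letters is $\{1,\dots,k\}$ for some $k=\max(u)$ ($\max$ of the empty word is $0$, and $\mathbf M_{12\cdots 0}$ means $\mathbf M_{\emptyset}=1$); $l(u)=n$, and $u$ is identified with the surjection $[n]\to[k]$, $i\mapsto u_i$. For a word $w$, $\mathrm{pack}(w)$ replaces the $i$-th smallest letter occurring in $w$ by $i$. $\mathbf{WQSym}$ (over a field $\mathbb K$ of characteristic zero) has basis $\mathbf M_u=\sum_{\mathrm{pack}(w)=u}w$, with product $\mathbf M_u\mathbf M_v=\sum\mathbf M_w$ over packed words $w=u'v'$ with $\mathrm{pack}(u')=u$, $\mathrm{pack}(v')=v$. Shifted concatenation: $\mathbf M_u\bullet\mathbf M_v=\mathbf M_{u\cdot v[\max u]}$, where $v[k]$ adds $k$ to each letter of $v$. Internal product: $\mathbf M_u*\mathbf M_v=\mathbf M_{v\circ u}$ if $l(v)=\max(u)$, and $0$ otherwise, extended bilinearly. -}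

module Defs where

open import Data.Nat using (ℕ; zero; suc; _+_; _⊔_; _≤ᵇ_; _≡ᵇ_)
open import Data.Nat.Properties using (_≟_)
open import Data.Bool using (Bool; true; false; _∧_; T; if_then_else_)
open import Data.List using (List; []; _∷_; _++_; map; concatMap; length; foldr; filterᵇ; take; drop; upTo)
open import Data.Bool.ListAction using (all; any)
open import Data.List.Properties using (≡-dec)
open import Relation.Nullary.Decidable using (⌊_⌋)
open import Relation.Binary.PropositionalEquality using (_≡_)

-- words over ℕ (letters are meant to be positive integers)
Word : Set
Word = List ℕ

maxW : Word → ℕ
maxW = foldr _⊔_ 0

elem : ℕ → Word → Bool
elem j = any (j ≡ᵇ_)

range1 : ℕ → Word
range1 n = map suc (upTo n)

isPackedᵇ : Word → Bool
isPackedᵇ w = all (1 ≤ᵇ_) w ∧ all (λ j → elem j w) (range1 (maxW w))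

IsPacked : Word → Set
IsPacked w = T (isPackedᵇ w)

rank : Word → ℕ → ℕ
rank w x = length (filterᵇ (λ y → elem y w) (upTo x))

-- pack: replace the i-th smallest letter occurring in w by i
pack : Word → Word
pack w = map (λ x → suc (rank w x)) w

_=ᵂ_ : Word → Word → Bool
u =ᵂ v = ⌊ ≡-dec _≟_ u v ⌋

allWords : ℕ → ℕ → List Word
allWords zero    k = [] ∷ []
allWords (suc n) k = concatMap (λ a → map (a ∷_) (allWords n k)) (range1 k)

-- An element of WQSym with ℕ coefficients in the M-basis, as a multiset
-- (list) of packed words: the list u₁ ∷ … ∷ uₘ ∷ [] stands for M_{u₁}+⋯+M_{uₘ}.
WQSym : Set
WQSym = List Word

coeff : Word → WQSym → ℕ
coeff w X = length (filterᵇ (w =ᵂ_) X)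

_≈_ : WQSym → WQSym → Set
X ≈ Y = ∀ w → coeff w X ≡ coeff w Y

M : Word → WQSym
M u = u ∷ []

one : WQSym
one = M []

-- M_u M_v = Σ M_w over packed w = u'v' with pack u' = u, pack v' = v
-- (a packed word of length n has letters in {1,…,n})
prodM : Word → Word → WQSym
prodM u v = filterᵇ
  (λ w → isPackedᵇ w ∧ (pack (take (length u) w) =ᵂ u) ∧ (pack (drop (length u) w) =ᵂ v))
  (allWords (length u + length v) (length u + length v))

_·_ : WQSym → WQSym → WQSym
X · Y = concatMap (λ u → concatMap (λ v → prodM u v) Y) X

prodList : List WQSym → WQSym
prodList = foldr _·_ one

shift : ℕ → Word → Word
shift k v = map (_+ k) v

_•ᵂ_ : Word → Word → Word
u •ᵂ v = u ++ shift (maxW u) v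

bulletList : List Word → Word
bulletList = foldr _•ᵂ_ []

-- v_i (1-indexed), 0 if out of range
nth : Word → ℕ → ℕ
nth []      _             = 0
nth (x ∷ v) zero          = 0
nth (x ∷ v) (suc zero)    = x
nth (x ∷ v) (suc (suc i)) = nth v (suc i)

compose : Word → Word → Word
compose v u = map (nth v) u

internalM : Word → Word → WQSym
internalM u v = if length v ≡ᵇ maxW u then M (compose v u) else []

_*_ : WQSym → WQSym → WQSym
X * Y = concatMap (λ u → concatMap (λ v → internalM u v) Y) X

Shat : List ℕ → WQSym
Shat is = prodList (map (λ i → M (range1 i)) is)

-- Compare coefficients of M_w. On the left M_w occurs (once) iff w is packed and its
-- consecutive blocks w_k of lengths l(u_k) satisfy pack w_k = u_k. On the right, b = u₁ • ⋯ • u_r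
-- is packed, so M_b * M_s contributes M_w iff w = s ∘ b, which determines s (s_j is the letter of
-- w at any position where b has the letter j); the coefficient is then that of M_s in Ŝ, i.e.
-- whether the blocks s_k of lengths i_k satisfy pack s_k = 12⋯i_k. Under w = s ∘ b the two
-- conditions agree: b sends the k-th block of positions onto the k-th block of letters, so
-- w_k = s_k ∘ u_k, and pack (s_k ∘ u_k) = pack s_k ∘ u_k because composing with a packed word
-- keeps the set of letters, hence the ranks; as s ↦ s ∘ u_k is injective, pack w_k = u_k = 12⋯i_k ∘ u_k
-- iff pack s_k = 12⋯i_k. Conversely s_k exists because pack w_k = u_k forces w_k to be constant on
-- the fibres of u_k.

module Submission where

open import Defs
open import Data.List using (List; map)
open import Data.List.Relation.Unary.All using (All)

open import Data.Bool using (Bool; true; false; _∧_; T; if_then_else_)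
open import Data.Bool.Properties using (T-∧; T-≡)
open import Data.Empty using (⊥-elim)
open import Data.List as List using ([]; _∷_; _++_; length; filterᵇ; take; drop; upTo; applyUpTo; concatMap)
import Data.List.Properties as List
open import Data.List.Membership.Propositional using (_∈_)
open import Data.List.Membership.Propositional.Properties using (∈-map⁺; ∈-map⁻; ∈-++⁺ˡ; ∈-++⁺ʳ; ∈-++⁻; ∈-upTo⁺; ∈-upTo⁻)
open import Data.List.Relation.Binary.Subset.Propositional using (_⊆_)
import Data.List.Relation.Unary.All as All
open import Data.List.Relation.Unary.All.Properties using (all⁺; all⁻)
import Data.List.Relation.Unary.Any as Any
open import Data.List.Relation.Unary.Any.Properties using (any⁺; any⁻; lookup-index)
open import Data.Fin as Fin using (Fin)
import Data.Fin.Properties as Fin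
open import Data.Nat.ListAction using (sum)
open import Data.Nat.ListAction.Properties using (sum-++)
open import Data.Nat using (ℕ; zero; suc; ≤′-refl; ≤′-step; _+_; _∸_; _⊔_; _≤_; _<_; z≤n; s≤s; _≡ᵇ_; _<ᵇ_) renaming (_*_ to _*ℕ_)
open import Data.Nat.Properties
open import Data.Product using (_×_; _,_; proj₁; proj₂)
open import Data.Sum using (inj₁; inj₂)
open import Function using (id; _∘_; _⇔_; mk⇔; Equivalence)
open import Relation.Binary.PropositionalEquality
open import Relation.Nullary using (¬_; yes; no)
open import Relation.Binary.Definitions using (tri<; tri≈; tri>)
open import Relation.Nullary.Decidable using (T?; toWitness; fromWitness)

open Equivalence using (to; from)

χ : Bool → ℕ
χ true  = 1
χ false = 0

χ-∧ : ∀ a b → χ (a ∧ b) ≡ χ a *ℕ χ b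
χ-∧ true  b = sym (+-identityʳ (χ b))
χ-∧ false b = refl

χ-true : ∀ {a} → T a → χ a ≡ 1
χ-true {true} _ = refl

χ-false : ∀ {a} → ¬ T a → χ a ≡ 0
χ-false {true}  ¬a = ⊥-elim (¬a _)
χ-false {false} ¬a = refl

T-ext : ∀ {a b} → (T a → T b) → (T b → T a) → a ≡ b
T-ext {true}  {true}  _ _ = refl
T-ext {true}  {false} f _ = ⊥-elim (f _)
T-ext {false} {true}  _ g = ⊥-elim (g _)
T-ext {false} {false} _ _ = refl

=ᵂ⇔≡ : ∀ {u v} → T (u =ᵂ v) ⇔ u ≡ v
=ᵂ⇔≡ = mk⇔ toWitness fromWitness

elem⇔∈ : ∀ {j w} → T (elem j w) ⇔ j ∈ w
elem⇔∈ {j} {w} = mk⇔ (Any.map (≡ᵇ⇒≡ j _) ∘ any⁻ _ w) (any⁺ _ ∘ Any.map (≡⇒≡ᵇ j _))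

∈-range1⁻ : ∀ {j m} → j ∈ range1 m → 1 ≤ j × j ≤ m
∈-range1⁻ j∈ with ∈-map⁻ suc j∈
... | _ , k∈ , refl = s≤s z≤n , ∈-upTo⁻ k∈

∈-range1⁺ : ∀ {j m} → 1 ≤ j → j ≤ m → j ∈ range1 m
∈-range1⁺ {suc k} (s≤s _) k<m = ∈-map⁺ suc (∈-upTo⁺ k<m)

∈⇒≤maxW : ∀ {a} w → a ∈ w → a ≤ maxW w
∈⇒≤maxW (x ∷ w) (Any.here refl) = m≤m⊔n x (maxW w)
∈⇒≤maxW (x ∷ w) (Any.there a∈) = ≤-trans (∈⇒≤maxW w a∈) (m≤n⊔m x (maxW w))

maxW-least : ∀ {m} w → (∀ {a} → a ∈ w → a ≤ m) → maxW w ≤ m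
maxW-least []      _ = z≤n
maxW-least (x ∷ w) f = ⊔-lub (f (Any.here refl)) (maxW-least w (f ∘ Any.there))

⊆⇒maxW-≤ : ∀ {x} y → x ⊆ y → maxW x ≤ maxW y
⊆⇒maxW-≤ {x} y x⊆y = maxW-least x (∈⇒≤maxW y ∘ x⊆y)

-- Packed words and ranks

record Packed (w : Word) : Set where
  field
    positive : ∀ {a} → a ∈ w → 1 ≤ a
    complete : ∀ {j} → 1 ≤ j → j ≤ maxW w → j ∈ w
open Packed

isPackedᵇ⇔Packed : ∀ {w} → IsPacked w ⇔ Packed w
isPackedᵇ⇔Packed {w} = mk⇔ ⇒ ⇐
  where
  ⇒ : IsPacked w → Packed w
  ⇒ h .positive a∈ = ≤ᵇ⇒≤ 1 _ (All.lookup (all⁺ _ w (proj₁ (to T-∧ h))) a∈)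
  ⇒ h .complete 1≤j j≤m = to elem⇔∈ (All.lookup (all⁺ _ _ (proj₂ (to T-∧ h))) (∈-range1⁺ 1≤j j≤m))
  ⇐ : Packed w → IsPacked w
  ⇐ p = from T-∧ ( all⁻ _ (All.tabulate (≤⇒≤ᵇ ∘ p .positive))
                 , all⁻ _ (All.tabulate λ j∈ → let 1≤j , j≤m = ∈-range1⁻ j∈ in from elem⇔∈ (p .complete 1≤j j≤m)))

Packed-resp : ∀ {x y} → x ⊆ y → y ⊆ x → Packed x → Packed y
Packed-resp x⊆y y⊆x p .positive = p .positive ∘ y⊆x
Packed-resp x⊆y y⊆x p .complete 1≤j j≤m = x⊆y (p .complete 1≤j (≤-trans j≤m (⊆⇒maxW-≤ _ y⊆x)))

Packed⇒maxW≤length : ∀ {w} → Packed w → maxW w ≤ length w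
Packed⇒maxW≤length {w} p = ≮⇒≥ λ l<m →
  let i , j , i<j , same-position = Fin.pigeonhole l<m (Any.index ∘ letter)
  in <-irrefl (suc-injective (begin
    suc (Fin.toℕ i)                      ≡⟨ lookup-index (letter i) ⟩
    List.lookup w (Any.index (letter i)) ≡⟨ cong (List.lookup w) same-position ⟩
    List.lookup w (Any.index (letter j)) ≡⟨ lookup-index (letter j) ⟨
    suc (Fin.toℕ j)                      ∎)) i<j
  where
  open ≡-Reasoning
  letter : (j : Fin (maxW w)) → suc (Fin.toℕ j) ∈ w
  letter j = p .complete (s≤s z≤n) (Fin.toℕ<n j)

rank-resp : ∀ {x y} → x ⊆ y → y ⊆ x → ∀ c → rank x c ≡ rank y c
rank-resp {x} {y} x⊆y y⊆x c = cong length (List.filter-≐ (T? ∘ (λ a → elem a x)) (T? ∘ (λ a → elem a y))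
  ( (λ {a} → from (elem⇔∈ {a}) ∘ x⊆y ∘ to elem⇔∈) , (λ {a} → from (elem⇔∈ {a}) ∘ y⊆x ∘ to elem⇔∈) ) (upTo c))

length-filterᵇ-singleton : ∀ {A : Set} {p : A → Bool} x → length (filterᵇ p (x ∷ [])) ≡ χ (p x)
length-filterᵇ-singleton {p = p} x with p x
... | true  = refl
... | false = refl

rank-suc : ∀ w c → rank w (suc c) ≡ rank w c + χ (elem c w)
rank-suc w c = begin
  length (filterᵇ P (upTo (suc c)))                      ≡⟨ cong (length ∘ filterᵇ P) (List.upTo-∷ʳ c) ⟨
  length (filterᵇ P (upTo c ++ c ∷ []))                  ≡⟨ cong length (List.filter-++ (T? ∘ P) (upTo c) (c ∷ [])) ⟩
  length (filterᵇ P (upTo c) ++ filterᵇ P (c ∷ []))      ≡⟨ List.length-++ (filterᵇ P (upTo c)) ⟩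
  rank w c + length (filterᵇ P (c ∷ []))                 ≡⟨ cong (rank w c +_) (length-filterᵇ-singleton {p = P} c) ⟩
  rank w c + χ (elem c w)                                ∎
  where
  open ≡-Reasoning
  P = λ y → elem y w

rank-suc-∈ : ∀ w {a} → a ∈ w → rank w (suc a) ≡ suc (rank w a)
rank-suc-∈ w {a} a∈ = trans (rank-suc w a) (trans (cong (rank w a +_) (χ-true (from elem⇔∈ a∈))) (+-comm _ 1))

rank-mono : ∀ w {a b} → a ≤ b → rank w a ≤ rank w b
rank-mono w {a} {b} a≤b with ≤⇒≤′ a≤b
... | ≤′-refl = ≤-refl
... | ≤′-step {n} a≤′n = ≤-trans (rank-mono w (≤′⇒≤ a≤′n)) (subst (rank w n ≤_) (sym (rank-suc w n)) (m≤m+n _ _))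

rank-strict : ∀ w {a b} → a ∈ w → a < b → rank w a < rank w b
rank-strict w a∈ a<b = subst (_≤ _) (rank-suc-∈ w a∈) (rank-mono w a<b)

rank-injective : ∀ w {a c} → a ∈ w → c ∈ w → rank w a ≡ rank w c → a ≡ c
rank-injective w {a} {c} a∈ c∈ eq with <-cmp a c
... | tri< a<c _ _ = ⊥-elim (<-irrefl eq (rank-strict w a∈ a<c))
... | tri≈ _ a≡c _ = a≡c
... | tri> _ _ c<a = ⊥-elim (<-irrefl (sym eq) (rank-strict w c∈ c<a))

length-pack : ∀ w → length (pack w) ≡ length w
length-pack w = List.length-map _ w

-- Composition of words

nth-applyUpTo : ∀ (f : ℕ → ℕ) {m i} → i < m → nth (applyUpTo f m) (suc i) ≡ f i
nth-applyUpTo f {suc m} {zero}  _         = refl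
nth-applyUpTo f {suc m} {suc i} (s≤s i<m) = nth-applyUpTo (f ∘ suc) i<m

map-range1 : ∀ (f : ℕ → ℕ) m → map f (range1 m) ≡ applyUpTo (f ∘ suc) m
map-range1 f m = trans (cong (map f) (List.map-applyUpTo id suc m)) (List.map-applyUpTo suc f m)

nth-map-range1 : ∀ (f : ℕ → ℕ) {m j} → 1 ≤ j → j ≤ m → nth (map f (range1 m)) j ≡ f j
nth-map-range1 f {m} {suc i} _ i<m = trans (cong (λ l → nth l (suc i)) (map-range1 f m)) (nth-applyUpTo (f ∘ suc) i<m)

nth-range1 : ∀ {m j} → 1 ≤ j → j ≤ m → nth (range1 m) j ≡ j
nth-range1 {m} {suc i} _ i<m = trans (cong (λ l → nth l (suc i)) (List.map-applyUpTo id suc m)) (nth-applyUpTo suc i<m)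

length-range1 : ∀ m → length (range1 m) ≡ m
length-range1 m = trans (List.length-map suc (upTo m)) (List.length-upTo m)

map-nth-range1 : ∀ s → map (nth s) (range1 (length s)) ≡ s
map-nth-range1 s = trans (map-range1 (nth s) (length s)) (applyUpTo-nth s)
  where
  applyUpTo-nth : ∀ s → applyUpTo (λ i → nth s (suc i)) (length s) ≡ s
  applyUpTo-nth []      = refl
  applyUpTo-nth (x ∷ s) = cong (x ∷_) (applyUpTo-nth s)

nth-map : ∀ (f : ℕ → ℕ) v {p} → 1 ≤ p → p ≤ length v → nth (map f v) p ≡ f (nth v p)
nth-map f (x ∷ v) {suc zero}    _ _         = refl
nth-map f (x ∷ v) {suc (suc p)} _ (s≤s p<) = nth-map f v (s≤s z≤n) p<

nth-∈ : ∀ v {p} → 1 ≤ p → p ≤ length v → nth v p ∈ v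
nth-∈ (x ∷ v) {suc zero}    _ _         = Any.here refl
nth-∈ (x ∷ v) {suc (suc p)} _ (s≤s p<) = Any.there (nth-∈ v (s≤s z≤n) p<)

nth-++ˡ : ∀ s₁ s₂ {p} → 1 ≤ p → p ≤ length s₁ → nth (s₁ ++ s₂) p ≡ nth s₁ p
nth-++ˡ (x ∷ s₁) s₂ {suc zero}    _ _         = refl
nth-++ˡ (x ∷ s₁) s₂ {suc (suc p)} _ (s≤s p<) = nth-++ˡ s₁ s₂ (s≤s z≤n) p<

nth-++ʳ : ∀ s₁ s₂ j → nth (s₁ ++ s₂) (suc j + length s₁) ≡ nth s₂ (suc j)
nth-++ʳ []       s₂ j = cong (nth s₂) (+-identityʳ (suc j))
nth-++ʳ (x ∷ s₁) s₂ j rewrite +-suc j (length s₁) = nth-++ʳ s₁ s₂ j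

nth-∷ : ∀ x v {p} → 1 ≤ p → nth (x ∷ v) (suc p) ≡ nth v p
nth-∷ x v {suc p} _ = refl

pos : ℕ → Word → ℕ
pos j []      = 0
pos j (x ∷ v) = if j ≡ᵇ x then 1 else suc (pos j v)

pos-spec : ∀ {j} v → j ∈ v → 1 ≤ pos j v × pos j v ≤ length v × nth v (pos j v) ≡ j
pos-spec {j} (x ∷ v) j∈ with j ≡ᵇ x in eq | j∈
... | true  | _             = s≤s z≤n , s≤s z≤n , sym (≡ᵇ⇒≡ j x (subst T (sym eq) _))
... | false | Any.here refl = ⊥-elim (subst T eq (≡⇒≡ᵇ j j refl))
... | false | Any.there j∈v =
  let 1≤p , p≤ , nth≡j = pos-spec v j∈v in s≤s z≤n , s≤s p≤ , trans (nth-∷ x v 1≤p) nth≡j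

pos-map : ∀ (ψ : ℕ → ℕ) {a} t → (∀ {c} → c ∈ t → ψ c ≡ ψ a → c ≡ a) → pos (ψ a) (map ψ t) ≡ pos a t
pos-map ψ     []      _   = refl
pos-map ψ {a} (x ∷ t) inj =
  cong₂ (λ b p → if b then 1 else suc p) same-test (pos-map ψ t (inj ∘ Any.there))
  where
  same-test : (ψ a ≡ᵇ ψ x) ≡ (a ≡ᵇ x)
  same-test = T-ext (λ h → ≡⇒≡ᵇ a x (sym (inj (Any.here refl) (sym (≡ᵇ⇒≡ _ _ h)))))
                    (λ h → ≡⇒≡ᵇ (ψ a) (ψ x) (cong ψ (≡ᵇ⇒≡ a x h)))

module _ {b : Word} (s : Word) (pb : Packed b) (len : length s ≡ maxW b) where

  letter-bounds : ∀ {a} → a ∈ b → 1 ≤ a × a ≤ length s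
  letter-bounds a∈ = pb .positive a∈ , subst (_ ≤_) (sym len) (∈⇒≤maxW b a∈)

  compose-⊆ : compose s b ⊆ s
  compose-⊆ c∈ with ∈-map⁻ (nth s) c∈
  ... | a , a∈ , refl = nth-∈ s (proj₁ (letter-bounds a∈)) (proj₂ (letter-bounds a∈))

  ⊆-compose : s ⊆ compose s b
  ⊆-compose c∈ =
    let 1≤p , p≤ , nth≡c = pos-spec s c∈
    in subst (_∈ compose s b) nth≡c (∈-map⁺ (nth s) (pb .complete 1≤p (subst (_ ≤_) len p≤)))

  pack-compose : pack (compose s b) ≡ compose (pack s) b
  pack-compose = trans (sym (List.map-∘ b)) (List.map-cong-local (All.tabulate λ {a} a∈ →
    let 1≤a , a≤ = letter-bounds a∈ in
    trans (cong suc (rank-resp compose-⊆ ⊆-compose (nth s a))) (sym (nth-map _ s 1≤a a≤))))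

compose-range1 : ∀ {u} → Packed u → compose (range1 (maxW u)) u ≡ u
compose-range1 {u} pu = List.map-id-local (All.tabulate λ a∈ → nth-range1 (pu .positive a∈) (∈⇒≤maxW u a∈))

-- leftFactor b d is the s with compose s b ≡ d: s_j is read off where b first has the letter j.
leftFactor : Word → Word → Word
leftFactor b d = map (λ j → nth d (pos j b)) (range1 (maxW b))

length-leftFactor : ∀ b d → length (leftFactor b d) ≡ maxW b
length-leftFactor b d = trans (List.length-map _ (range1 (maxW b))) (length-range1 (maxW b))

leftFactor-compose : ∀ {b s} → Packed b → length s ≡ maxW b → leftFactor b (compose s b) ≡ s
leftFactor-compose {b} {s} pb len = begin
  leftFactor b (compose s b)      ≡⟨ List.map-cong-local (All.tabulate nth-at-pos) ⟩
  map (nth s) (range1 (maxW b))   ≡⟨ cong (map (nth s) ∘ range1) len ⟨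
  map (nth s) (range1 (length s)) ≡⟨ map-nth-range1 s ⟩
  s                               ∎
  where
  open ≡-Reasoning
  nth-at-pos : ∀ {j} → j ∈ range1 (maxW b) → nth (compose s b) (pos j b) ≡ nth s j
  nth-at-pos j∈ =
    let 1≤j , j≤ = ∈-range1⁻ j∈
        1≤p , p≤ , nth≡j = pos-spec b (pb .complete 1≤j j≤)
    in trans (nth-map (nth s) b 1≤p p≤) (cong (nth s) nth≡j)

compose-injective : ∀ {b} s s′ → Packed b → length s ≡ maxW b → length s′ ≡ maxW b →
                    compose s b ≡ compose s′ b → s ≡ s′
compose-injective {b} s s′ pb len len′ eq =
  trans (sym (leftFactor-compose pb len)) (trans (cong (leftFactor b) eq) (leftFactor-compose pb len′))

compose-leftFactor : ∀ {b} (h : ℕ → ℕ) → Packed b → compose (leftFactor b (map h b)) b ≡ map h b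
compose-leftFactor {b} h pb = List.map-cong-local (All.tabulate λ {a} a∈ →
  let 1≤p , p≤ , nth≡a = pos-spec b a∈ in begin
  nth (leftFactor b (map h b)) a  ≡⟨ nth-map-range1 _ (pb .positive a∈) (∈⇒≤maxW b a∈) ⟩
  nth (map h b) (pos a b)         ≡⟨ nth-map h b 1≤p p≤ ⟩
  h (nth b (pos a b))             ≡⟨ cong h nth≡a ⟩
  h a                             ∎)
  where open ≡-Reasoning

unpack : Word → ℕ → ℕ
unpack t y = nth t (pos y (pack t))

map-unpack-pack : ∀ t → map (unpack t) (pack t) ≡ t
map-unpack-pack t = trans (sym (List.map-∘ t)) (List.map-id-local (All.tabulate λ {a} a∈ →
  trans (cong (nth t) (pos-map ψ t (λ c∈ ψc≡ψa → rank-injective t c∈ a∈ (suc-injective ψc≡ψa))))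
        (proj₂ (proj₂ (pos-spec t a∈)))))
  where
  ψ : ℕ → ℕ
  ψ x = suc (rank t x)

compose-leftFactor-pack : ∀ {b t} y → Packed b → pack t ≡ compose y b → compose (leftFactor b t) b ≡ t
compose-leftFactor-pack {b} {t} y pb eq = begin
  compose (leftFactor b t) b         ≡⟨ cong (λ d → compose (leftFactor b d) b) t≡ ⟩
  compose (leftFactor b (map h b)) b ≡⟨ compose-leftFactor h pb ⟩
  map h b                            ≡⟨ t≡ ⟨
  t                                  ∎
  where
  open ≡-Reasoning
  h : ℕ → ℕ
  h = unpack t ∘ nth y
  t≡ : t ≡ map h b
  t≡ = begin
    t                                ≡⟨ map-unpack-pack t ⟨
    map (unpack t) (pack t)          ≡⟨ cong (map (unpack t)) eq ⟩
    map (unpack t) (map (nth y) b)   ≡⟨ List.map-∘ b ⟨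
    map h b                          ∎

pack-leftFactor : ∀ {b t y} → Packed b → length y ≡ maxW b → pack t ≡ compose y b → pack (leftFactor b t) ≡ y
pack-leftFactor {b} {t} {y} pb leny eq = compose-injective (pack (leftFactor b t)) y pb len leny (begin
  compose (pack (leftFactor b t)) b  ≡⟨ pack-compose (leftFactor b t) pb (length-leftFactor b t) ⟨
  pack (compose (leftFactor b t) b)  ≡⟨ cong pack (compose-leftFactor-pack y pb eq) ⟩
  pack t                             ≡⟨ eq ⟩
  compose y b                        ∎)
  where
  open ≡-Reasoning
  len : length (pack (leftFactor b t)) ≡ maxW b
  len = trans (length-pack (leftFactor b t)) (length-leftFactor b t)

-- Shifted concatenation

maxW-++ : ∀ xs ys → maxW (xs ++ ys) ≡ maxW xs ⊔ maxW ys
maxW-++ []       ys = refl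
maxW-++ (x ∷ xs) ys = trans (cong (x ⊔_) (maxW-++ xs ys)) (sym (⊔-assoc x (maxW xs) (maxW ys)))

-- The k ⊔ accounts for the empty word, whose shift has maximum 0.
maxW-shift : ∀ k v → k ⊔ maxW (shift k v) ≡ k + maxW v
maxW-shift k []      = trans (⊔-identityʳ k) (sym (+-identityʳ k))
maxW-shift k (x ∷ v) = begin
  k ⊔ ((x + k) ⊔ maxW (shift k v))  ≡⟨ ⊔-assoc k (x + k) _ ⟨
  (k ⊔ (x + k)) ⊔ maxW (shift k v)  ≡⟨ cong (_⊔ maxW (shift k v)) (⊔-comm k (x + k)) ⟩
  ((x + k) ⊔ k) ⊔ maxW (shift k v)  ≡⟨ ⊔-assoc (x + k) k _ ⟩
  (x + k) ⊔ (k ⊔ maxW (shift k v))  ≡⟨ cong₂ _⊔_ (+-comm x k) (maxW-shift k v) ⟩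
  (k + x) ⊔ (k + maxW v)            ≡⟨ +-distribˡ-⊔ k x (maxW v) ⟨
  k + (x ⊔ maxW v)                  ∎
  where open ≡-Reasoning

maxW-• : ∀ u v → maxW (u •ᵂ v) ≡ maxW u + maxW v
maxW-• u v = trans (maxW-++ u (shift (maxW u) v)) (maxW-shift (maxW u) v)

Packed-• : ∀ {u v} → Packed u → Packed v → Packed (u •ᵂ v)
Packed-• {u} {v} pu pv .positive a∈ with ∈-++⁻ u a∈
... | inj₁ a∈u = pu .positive a∈u
... | inj₂ a∈s with ∈-map⁻ (_+ maxW u) a∈s
...   | y , y∈ , refl = ≤-trans (pv .positive y∈) (m≤m+n y (maxW u))
Packed-• {u} {v} pu pv .complete {j} 1≤j j≤ with j ≤? maxW u
... | yes j≤i = ∈-++⁺ˡ (pu .complete 1≤j j≤i)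
... | no  j≰i = ∈-++⁺ʳ u (subst (_∈ shift i v) (m∸n+n≡m i≤j) (∈-map⁺ (_+ i) (pv .complete 1≤k k≤)))
  where
  i = maxW u
  i≤j : i ≤ j
  i≤j = <⇒≤ (≰⇒> j≰i)
  1≤k : 1 ≤ j ∸ i
  1≤k = m<n⇒0<n∸m (≰⇒> j≰i)
  k≤ : j ∸ i ≤ maxW v
  k≤ = m≤n+o⇒m∸n≤o j i (subst (j ≤_) (maxW-• u v) j≤)

Packed-bullet : ∀ {us} → All Packed us → Packed (bulletList us)
Packed-bullet All.[]         = record { positive = λ () ; complete = λ { (s≤s _) () } }
Packed-bullet (pu All.∷ pus) = Packed-• pu (Packed-bullet pus)

compose-• : ∀ {u v} s₁ s₂ → Packed u → Packed v → length s₁ ≡ maxW u →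
            compose (s₁ ++ s₂) (u •ᵂ v) ≡ compose s₁ u ++ compose s₂ v
compose-• {u} {v} s₁ s₂ pu pv len = trans (List.map-++ (nth (s₁ ++ s₂)) u (shift (maxW u) v)) (cong₂ _++_ left right)
  where
  left : map (nth (s₁ ++ s₂)) u ≡ map (nth s₁) u
  left = List.map-cong-local (All.tabulate λ a∈ →
    nth-++ˡ s₁ s₂ (pu .positive a∈) (subst (_ ≤_) (sym len) (∈⇒≤maxW u a∈)))
  right : map (nth (s₁ ++ s₂)) (shift (maxW u) v) ≡ map (nth s₂) v
  right = trans (sym (List.map-∘ v)) (List.map-cong-local (All.tabulate shifted))
    where
    shifted : ∀ {a} → a ∈ v → nth (s₁ ++ s₂) (a + maxW u) ≡ nth s₂ a
    shifted a∈ with pv .positive a∈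
    shifted {suc a} a∈ | s≤s _ = subst (λ n → nth (s₁ ++ s₂) (suc a + n) ≡ nth s₂ (suc a)) len (nth-++ʳ s₁ s₂ a)

-- Coefficients in the M-basis

coeff-∷ : ∀ w x X → coeff w (x ∷ X) ≡ χ (w =ᵂ x) + coeff w X
coeff-∷ w x X with w =ᵂ x
... | true  = refl
... | false = refl

coeff-∷-≢ : ∀ {w x X} → ¬ T (w =ᵂ x) → coeff w (x ∷ X) ≡ coeff w X
coeff-∷-≢ {w} {x} {X} w≢x = trans (coeff-∷ w x X) (cong (_+ coeff w X) (χ-false w≢x))

coeff-++ : ∀ w X Y → coeff w (X ++ Y) ≡ coeff w X + coeff w Y
coeff-++ w X Y = trans (cong length (List.filter-++ (T? ∘ (w =ᵂ_)) X Y)) (List.length-++ (filterᵇ (w =ᵂ_) X))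

coeff-concatMap : ∀ {A : Set} w (f : A → WQSym) L → coeff w (concatMap f L) ≡ sum (map (coeff w ∘ f) L)
coeff-concatMap w f []      = refl
coeff-concatMap w f (v ∷ L) = trans (coeff-++ w (f v) (concatMap f L)) (cong (coeff w (f v) +_) (coeff-concatMap w f L))

coeff-filterᵇ : ∀ (p : Word → Bool) w X → coeff w (filterᵇ p X) ≡ χ (p w) *ℕ coeff w X
coeff-filterᵇ p w []      = sym (*-zeroʳ (χ (p w)))
coeff-filterᵇ p w (x ∷ X) with p x in px | T? (w =ᵂ x)
... | true  | no w≢x = trans (coeff-∷-≢ w≢x) (trans (coeff-filterᵇ p w X) (cong (χ (p w) *ℕ_) (sym (coeff-∷-≢ w≢x))))
... | false | no w≢x = trans (coeff-filterᵇ p w X) (cong (χ (p w) *ℕ_) (sym (coeff-∷-≢ w≢x)))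
... | true  | yes w≡x with refl ← to =ᵂ⇔≡ w≡x rewrite px = begin
  coeff w (w ∷ filterᵇ p X)             ≡⟨ coeff-∷ w w _ ⟩
  χ (w =ᵂ w) + coeff w (filterᵇ p X)    ≡⟨ cong (χ (w =ᵂ w) +_) (trans (coeff-filterᵇ p w X) (cong (λ b → χ b *ℕ _) px)) ⟩
  χ (w =ᵂ w) + (coeff w X + 0)          ≡⟨ cong (χ (w =ᵂ w) +_) (+-identityʳ _) ⟩
  χ (w =ᵂ w) + coeff w X                ≡⟨ coeff-∷ w w X ⟨
  coeff w (w ∷ X)                       ≡⟨ +-identityʳ _ ⟨
  1 *ℕ coeff w (w ∷ X)                  ∎
  where open ≡-Reasoning
... | false | yes w≡x with refl ← to =ᵂ⇔≡ w≡x rewrite px = trans (coeff-filterᵇ p w X) (cong (λ b → χ b *ℕ _) px)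

sum-χ-unique : ∀ (c : Word → Bool) x → (∀ v → T (c v) → v ≡ x) →
               ∀ L → sum (map (χ ∘ c) L) ≡ χ (c x) *ℕ coeff x L
sum-χ-unique c x unique []      = sym (*-zeroʳ (χ (c x)))
sum-χ-unique c x unique (v ∷ L) = begin
  χ (c v) + sum (map (χ ∘ c) L)                ≡⟨ cong₂ _+_ (trans (cong χ c-v) (χ-∧ (c x) (x =ᵂ v))) (sum-χ-unique c x unique L) ⟩
  χ (c x) *ℕ χ (x =ᵂ v) + χ (c x) *ℕ coeff x L ≡⟨ *-distribˡ-+ (χ (c x)) _ _ ⟨
  χ (c x) *ℕ (χ (x =ᵂ v) + coeff x L)          ≡⟨ cong (χ (c x) *ℕ_) (coeff-∷ x v L) ⟨
  χ (c x) *ℕ coeff x (v ∷ L)                   ∎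
  where
  open ≡-Reasoning
  c-v : c v ≡ (c x ∧ (x =ᵂ v))
  c-v = T-ext (λ h → let v≡x = unique v h in from T-∧ (subst (T ∘ c) v≡x h , from =ᵂ⇔≡ (sym v≡x)))
              (λ h → let cx , x≡v = to T-∧ h in subst (T ∘ c) (to =ᵂ⇔≡ x≡v) cx)

coeff-concatMap-unique : ∀ {w x} (f : Word → WQSym) (c : Word → Bool) →
                         (∀ v → coeff w (f v) ≡ χ (c v)) → (∀ v → T (c v) → v ≡ x) →
                         ∀ Y → coeff w (concatMap f Y) ≡ χ (c x) *ℕ coeff x Y
coeff-concatMap-unique {w} {x} f c coeff-f unique Y = begin
  coeff w (concatMap f Y)        ≡⟨ coeff-concatMap w f Y ⟩
  sum (map (coeff w ∘ f) Y)      ≡⟨ cong sum (List.map-cong coeff-f Y) ⟩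
  sum (map (χ ∘ c) Y)            ≡⟨ sum-χ-unique c x unique Y ⟩
  χ (c x) *ℕ coeff x Y           ∎
  where open ≡-Reasoning

range1-suc : ∀ k → range1 (suc k) ≡ range1 k ++ suc k ∷ []
range1-suc k = trans (cong (map suc) (sym (List.upTo-∷ʳ k))) (List.map-++ suc (upTo k) (k ∷ []))

χ-<ᵇ-suc : ∀ x k → χ (x <ᵇ k) + χ (x ≡ᵇ k) ≡ χ (x <ᵇ suc k)
χ-<ᵇ-suc zero    zero    = refl
χ-<ᵇ-suc zero    (suc k) = refl
χ-<ᵇ-suc (suc x) zero    = refl
χ-<ᵇ-suc (suc x) (suc k) = χ-<ᵇ-suc x k

count-range1 : ∀ x k → sum (map (λ a → χ (suc x ≡ᵇ a)) (range1 k)) ≡ χ (x <ᵇ k)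
count-range1 x zero    = refl
count-range1 x (suc k) = begin
  sum (map D (range1 (suc k)))                  ≡⟨ cong (sum ∘ map D) (range1-suc k) ⟩
  sum (map D (range1 k ++ suc k ∷ []))          ≡⟨ cong sum (List.map-++ D (range1 k) (suc k ∷ [])) ⟩
  sum (map D (range1 k) ++ D (suc k) ∷ [])      ≡⟨ sum-++ (map D (range1 k)) (D (suc k) ∷ []) ⟩
  sum (map D (range1 k)) + (χ (x ≡ᵇ k) + 0)     ≡⟨ cong₂ _+_ (count-range1 x k) (+-identityʳ _) ⟩
  χ (x <ᵇ k) + χ (x ≡ᵇ k)                       ≡⟨ χ-<ᵇ-suc x k ⟩
  χ (x <ᵇ suc k)                                ∎
  where
  open ≡-Reasoning
  D : ℕ → ℕ
  D a = χ (suc x ≡ᵇ a)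

coeff-map-∷ : ∀ a x w A → coeff (x ∷ w) (map (a ∷_) A) ≡ χ (x ≡ᵇ a) *ℕ coeff w A
coeff-map-∷ a x w []      = sym (*-zeroʳ (χ (x ≡ᵇ a)))
coeff-map-∷ a x w (y ∷ A) = begin
  coeff (x ∷ w) (map (a ∷_) (y ∷ A))                        ≡⟨ coeff-∷ (x ∷ w) (a ∷ y) _ ⟩
  χ ((x ∷ w) =ᵂ (a ∷ y)) + coeff (x ∷ w) (map (a ∷_) A)
    ≡⟨ cong₂ _+_ (trans (cong χ =ᵂ-∷) (χ-∧ (x ≡ᵇ a) (w =ᵂ y))) (coeff-map-∷ a x w A) ⟩
  χ (x ≡ᵇ a) *ℕ χ (w =ᵂ y) + χ (x ≡ᵇ a) *ℕ coeff w A        ≡⟨ *-distribˡ-+ (χ (x ≡ᵇ a)) _ _ ⟨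
  χ (x ≡ᵇ a) *ℕ (χ (w =ᵂ y) + coeff w A)                    ≡⟨ cong (χ (x ≡ᵇ a) *ℕ_) (coeff-∷ w y A) ⟨
  χ (x ≡ᵇ a) *ℕ coeff w (y ∷ A)                             ∎
  where
  open ≡-Reasoning
  =ᵂ-∷ : ((x ∷ w) =ᵂ (a ∷ y)) ≡ ((x ≡ᵇ a) ∧ (w =ᵂ y))
  =ᵂ-∷ = T-ext
    (λ h → let x≡a , w≡y = List.∷-injective (to =ᵂ⇔≡ h) in from T-∧ (≡⇒≡ᵇ x a x≡a , from =ᵂ⇔≡ w≡y))
    (λ h → let x=a , w=y = to T-∧ h in from =ᵂ⇔≡ (cong₂ _∷_ (≡ᵇ⇒≡ x a x=a) (to =ᵂ⇔≡ w=y)))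

coeff-[]-map-∷ : ∀ a A → coeff [] (map (a ∷_) A) ≡ 0
coeff-[]-map-∷ a []      = refl
coeff-[]-map-∷ a (y ∷ A) = coeff-[]-map-∷ a A

sum-*ʳ : ∀ {A : Set} (f : A → ℕ) n L → sum (map (λ a → f a *ℕ n) L) ≡ sum (map f L) *ℕ n
sum-*ʳ f n []      = refl
sum-*ʳ f n (a ∷ L) = trans (cong (f a *ℕ n +_) (sum-*ʳ f n L)) (sym (*-distribʳ-+ n (f a) (sum (map f L))))

coeff-[]-concatMap-∷ : ∀ A L → coeff [] (concatMap (λ a → map (a ∷_) A) L) ≡ 0
coeff-[]-concatMap-∷ A []      = refl
coeff-[]-concatMap-∷ A (a ∷ L) =
  trans (coeff-++ [] (map (a ∷_) A) _) (cong₂ _+_ (coeff-[]-map-∷ a A) (coeff-[]-concatMap-∷ A L))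

coeff-allWords : ∀ n k w → (∀ {a} → a ∈ w → 1 ≤ a × a ≤ k) → coeff w (allWords n k) ≡ χ (length w ≡ᵇ n)
coeff-allWords zero    k []       _      = refl
coeff-allWords zero    k (x ∷ w)  _      = refl
coeff-allWords (suc n) k []       _      = coeff-[]-concatMap-∷ (allWords n k) (range1 k)
coeff-allWords (suc n) k (x ∷ w) bounds = begin
  coeff (x ∷ w) (concatMap (λ a → map (a ∷_) A) (range1 k))          ≡⟨ coeff-concatMap (x ∷ w) _ (range1 k) ⟩
  sum (map (λ a → coeff (x ∷ w) (map (a ∷_) A)) (range1 k))          ≡⟨ cong sum (List.map-cong (λ a → coeff-map-∷ a x w A) (range1 k)) ⟩
  sum (map (λ a → χ (x ≡ᵇ a) *ℕ coeff w A) (range1 k))               ≡⟨ sum-*ʳ (λ a → χ (x ≡ᵇ a)) _ (range1 k) ⟩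
  sum (map (λ a → χ (x ≡ᵇ a)) (range1 k)) *ℕ coeff w A
    ≡⟨ cong₂ _*ℕ_ x-occurs-once (coeff-allWords n k w (bounds ∘ Any.there)) ⟩
  1 *ℕ χ (length w ≡ᵇ n)                                             ≡⟨ *-identityˡ _ ⟩
  χ (length w ≡ᵇ n)                                                  ∎
  where
  open ≡-Reasoning
  A = allWords n k
  x-occurs-once : sum (map (λ a → χ (x ≡ᵇ a)) (range1 k)) ≡ 1
  x-occurs-once with bounds (Any.here refl)
  ... | s≤s {n = x′} _ , x≤k = trans (count-range1 x′ k) (χ-true (<⇒<ᵇ x≤k))

χ-*-1 : ∀ a {n} → (T a → n ≡ 1) → χ a *ℕ n ≡ χ a
χ-*-1 true  n≡1 = trans (+-identityʳ _) (n≡1 _)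
χ-*-1 false _   = refl

splitsᵇ : Word → Word → Word → Bool
splitsᵇ u v w = isPackedᵇ w ∧ (pack (take (length u) w) =ᵂ u) ∧ (pack (drop (length u) w) =ᵂ v)

length-split : ∀ {u v} w → pack (take (length u) w) ≡ u → pack (drop (length u) w) ≡ v →
               length w ≡ length u + length v
length-split {u} {v} w take≡u drop≡v = begin
  length w                     ≡⟨ m+[n∸m]≡n n≤l ⟨
  n + (length w ∸ n)           ≡⟨ cong (n +_) (List.length-drop n w) ⟨
  n + length (drop n w)        ≡⟨ cong (n +_) (length-pack (drop n w)) ⟨
  n + length (pack (drop n w)) ≡⟨ cong (λ x → n + length x) drop≡v ⟩
  n + length v                 ∎
  where
  open ≡-Reasoning
  n = length u
  n≤l : n ≤ length w
  n≤l = m⊓n≡m⇒m≤n (trans (sym (List.length-take n w)) (trans (sym (length-pack (take n w))) (cong length take≡u)))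

Splits : Word → Word → Word → Set
Splits u v w = Packed w × pack (take (length u) w) ≡ u × pack (drop (length u) w) ≡ v

splitsᵇ⇔Splits : ∀ u v w → T (splitsᵇ u v w) ⇔ Splits u v w
splitsᵇ⇔Splits u v w = mk⇔
  (λ h → let packed , rest = to T-∧ h ; take=u , drop=v = to T-∧ rest
         in to isPackedᵇ⇔Packed packed , to =ᵂ⇔≡ take=u , to =ᵂ⇔≡ drop=v)
  (λ (pw , take≡u , drop≡v) →
     from T-∧ (from isPackedᵇ⇔Packed pw , from T-∧ (from =ᵂ⇔≡ take≡u , from =ᵂ⇔≡ drop≡v)))

coeff-prodM : ∀ u v w → coeff w (prodM u v) ≡ χ (splitsᵇ u v w)
coeff-prodM u v w = trans (coeff-filterᵇ (splitsᵇ u v) w (allWords N N)) (χ-*-1 (splitsᵇ u v w) enumerated)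
  where
  N = length u + length v
  -- prodM only enumerates words of length N with letters ≤ N; every splitting word is among them.
  enumerated : T (splitsᵇ u v w) → coeff w (allWords N N) ≡ 1
  enumerated h = trans (coeff-allWords N N w bounds) (χ-true (≡⇒≡ᵇ _ _ len))
    where
    splits : Splits u v w
    splits = to (splitsᵇ⇔Splits u v w) h
    pw = proj₁ splits
    len : length w ≡ N
    len = length-split w (proj₁ (proj₂ splits)) (proj₂ (proj₂ splits))
    bounds : ∀ {a} → a ∈ w → 1 ≤ a × a ≤ N
    bounds a∈ = pw .positive a∈ , ≤-trans (∈⇒≤maxW w a∈) (subst (maxW w ≤_) len (Packed⇒maxW≤length pw))

factorsᵇ : List Word → Word → Bool
factorsᵇ []       w = w =ᵂ []
factorsᵇ (u ∷ us) w = splitsᵇ u (pack (drop (length u) w)) w ∧ factorsᵇ us (pack (drop (length u) w))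

-- M_w occurs in M_{u₁}(M_{u₂}(⋯M_{u_r})), the bracketing used by prodList.
Factors : List Word → Word → Set
Factors []       w = w ≡ []
Factors (u ∷ us) w = Packed w × pack (take (length u) w) ≡ u × Factors us (pack (drop (length u) w))

factorsᵇ⇔Factors : ∀ us {w} → T (factorsᵇ us w) ⇔ Factors us w
factorsᵇ⇔Factors []       = =ᵂ⇔≡
factorsᵇ⇔Factors (u ∷ us) {w} = mk⇔
  (λ h → let splits , rest = to T-∧ h ; pw , take≡u , _ = to (splitsᵇ⇔Splits u _ w) splits
         in pw , take≡u , to (factorsᵇ⇔Factors us) rest)
  (λ (pw , take≡u , rest) → from T-∧ (from (splitsᵇ⇔Splits u _ w) (pw , take≡u , refl) , from (factorsᵇ⇔Factors us) rest))

coeff-prodList : ∀ us w → coeff w (prodList (map M us)) ≡ χ (factorsᵇ us w)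
coeff-prodList []       w = trans (coeff-∷ w [] []) (+-identityʳ _)
coeff-prodList (u ∷ us) w = begin
  coeff w (concatMap (prodM u) Y ++ [])                 ≡⟨ cong (coeff w) (List.++-identityʳ (concatMap (prodM u) Y)) ⟩
  coeff w (concatMap (prodM u) Y)                       ≡⟨ coeff-concatMap-unique (prodM u) (λ v → splitsᵇ u v w)
                                                                                  (λ v → coeff-prodM u v w) unique Y ⟩
  χ (splitsᵇ u x w) *ℕ coeff x Y                        ≡⟨ cong (χ (splitsᵇ u x w) *ℕ_) (coeff-prodList us x) ⟩
  χ (splitsᵇ u x w) *ℕ χ (factorsᵇ us x)                ≡⟨ χ-∧ (splitsᵇ u x w) _ ⟨
  χ (factorsᵇ (u ∷ us) w)                               ∎
  where
  open ≡-Reasoning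
  Y = prodList (map M us)
  x = pack (drop (length u) w)
  unique : ∀ v → T (splitsᵇ u v w) → v ≡ x
  unique v h = sym (proj₂ (proj₂ (to (splitsᵇ⇔Splits u v w) h)))

coeff-M* : ∀ {b} → Packed b → ∀ w S →
           coeff w (M b * S) ≡ χ (w =ᵂ compose (leftFactor b w) b) *ℕ coeff (leftFactor b w) S
coeff-M* {b} pb w S = begin
  coeff w (concatMap (internalM b) S ++ [])    ≡⟨ cong (coeff w) (List.++-identityʳ (concatMap (internalM b) S)) ⟩
  coeff w (concatMap (internalM b) S)          ≡⟨ coeff-concatMap-unique (internalM b) c coeff-internalM unique S ⟩
  χ (c g) *ℕ coeff g S                         ≡⟨ cong (λ l → χ (l ∧ (w =ᵂ compose g b)) *ℕ coeff g S) length-g ⟩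
  χ (w =ᵂ compose g b) *ℕ coeff g S            ∎
  where
  open ≡-Reasoning
  g = leftFactor b w
  c : Word → Bool
  c s = (length s ≡ᵇ maxW b) ∧ (w =ᵂ compose s b)
  coeff-internalM : ∀ s → coeff w (internalM b s) ≡ χ (c s)
  coeff-internalM s with length s ≡ᵇ maxW b
  ... | true  = trans (coeff-∷ w _ []) (+-identityʳ _)
  ... | false = refl
  unique : ∀ s → T (c s) → s ≡ g
  unique s h = let len , w=sb = to T-∧ h in
    sym (trans (cong (leftFactor b) (to =ᵂ⇔≡ w=sb)) (leftFactor-compose pb (≡ᵇ⇒≡ _ _ len)))
  length-g : (length g ≡ᵇ maxW b) ≡ true
  length-g = to T-≡ (≡⇒≡ᵇ _ _ (length-leftFactor b w))

-- Factorisations of both sides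

take-++ : ∀ {A : Set} {n} (xs ys : List A) → length xs ≡ n → take n (xs ++ ys) ≡ xs
take-++ []       ys refl = refl
take-++ (x ∷ xs) ys refl = cong (x ∷_) (take-++ xs ys refl)

drop-++ : ∀ {A : Set} {n} (xs ys : List A) → length xs ≡ n → drop n (xs ++ ys) ≡ ys
drop-++ []       ys refl = refl
drop-++ (x ∷ xs) ys refl = drop-++ xs ys refl

-- standards us = 12⋯i₁ ∷ ⋯ ∷ 12⋯i_r, whose M-product is Ŝ^{(i₁,…,i_r)}.
standards : List Word → List Word
standards = map (range1 ∘ maxW)

factors-compose : ∀ {us} → All Packed us → ∀ {s} → length s ≡ maxW (bulletList us) →
                  Factors (standards us) s → Factors us (compose s (bulletList us))
factors-compose All.[]                _   _                          = refl
factors-compose {u ∷ us} (pu All.∷ pus) {s} len (ps , pack-take-s , rest) = pw , pack-take , IH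
  where
  b′ = bulletList us
  pb′ = Packed-bullet pus
  i = maxW u
  s₁ = take i s
  s₂ = drop i s
  pack-s₁ : pack s₁ ≡ range1 i
  pack-s₁ = subst (λ n → pack (take n s) ≡ range1 i) (length-range1 i) pack-take-s
  rest₂ : Factors (standards us) (pack s₂)
  rest₂ = subst (λ n → Factors (standards us) (pack (drop n s))) (length-range1 i) rest
  len-s : length s ≡ i + maxW b′
  len-s = trans len (maxW-• u b′)
  len₁ : length s₁ ≡ i
  len₁ = trans (List.length-take i s) (m≤n⇒m⊓n≡m (subst (i ≤_) (sym len-s) (m≤m+n i _)))
  len₂ : length s₂ ≡ maxW b′
  len₂ = trans (List.length-drop i s) (trans (cong (_∸ i) len-s) (m+n∸m≡n i _))
  w-split : compose s (u •ᵂ b′) ≡ compose s₁ u ++ compose s₂ b′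
  w-split = trans (cong (λ z → compose z (u •ᵂ b′)) (sym (List.take++drop≡id i s))) (compose-• s₁ s₂ pu pb′ len₁)
  len-w₁ : length (compose s₁ u) ≡ length u
  len-w₁ = List.length-map (nth s₁) u
  pw : Packed (compose s (u •ᵂ b′))
  pw = Packed-resp (⊆-compose s (Packed-• pu pb′) len) (compose-⊆ s (Packed-• pu pb′) len) ps
  pack-take : pack (take (length u) (compose s (u •ᵂ b′))) ≡ u
  pack-take = begin
    pack (take (length u) (compose s (u •ᵂ b′)))  ≡⟨ cong (pack ∘ take (length u)) w-split ⟩
    pack (take (length u) (compose s₁ u ++ _))    ≡⟨ cong pack (take-++ (compose s₁ u) _ len-w₁) ⟩
    pack (compose s₁ u)                           ≡⟨ pack-compose s₁ pu len₁ ⟩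
    compose (pack s₁) u                           ≡⟨ cong (λ z → compose z u) pack-s₁ ⟩
    compose (range1 i) u                          ≡⟨ compose-range1 pu ⟩
    u                                             ∎
    where open ≡-Reasoning
  drop-w : drop (length u) (compose s (u •ᵂ b′)) ≡ compose s₂ b′
  drop-w = trans (cong (drop (length u)) w-split) (drop-++ (compose s₁ u) _ len-w₁)
  IH : Factors us (pack (drop (length u) (compose s (u •ᵂ b′))))
  IH = subst (Factors us) (sym (trans (cong pack drop-w) (pack-compose s₂ pb′ len₂)))
             (factors-compose pus (trans (length-pack s₂) len₂) rest₂)

record Decomposition (us : List Word) (w : Word) : Set where
  constructor decomposition
  field
    outer         : Word
    length-outer  : length outer ≡ maxW (bulletList us)
    compose-outer : compose outer (bulletList us) ≡ w
    factors-outer : Factors (standards us) outer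
open Decomposition

factors-decompose : ∀ {us} → All Packed us → ∀ {w} → Factors us w → Decomposition us w
factors-decompose All.[]                  refl                   = decomposition [] refl refl refl
factors-decompose {u ∷ us} (pu All.∷ pus) {w} (pw , pack-t , rest) =
  decomposition (s₁ ++ s₂) len comp (ps , pack-take-s , subst (Factors (standards us)) (sym pack-drop-s) (IH .factors-outer))
  where
  IH = factors-decompose pus rest
  b′ = bulletList us
  pb′ = Packed-bullet pus
  pb = Packed-• pu pb′
  i = maxW u
  t = take (length u) w
  d = drop (length u) w
  s₁ = leftFactor u t
  s₂ = leftFactor b′ d
  pack-t′ : pack t ≡ compose (range1 i) u
  pack-t′ = trans pack-t (sym (compose-range1 pu))
  comp : compose (s₁ ++ s₂) (u •ᵂ b′) ≡ w
  comp = begin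
    compose (s₁ ++ s₂) (u •ᵂ b′)    ≡⟨ compose-• s₁ s₂ pu pb′ (length-leftFactor u t) ⟩
    compose s₁ u ++ compose s₂ b′   ≡⟨ cong₂ _++_ (compose-leftFactor-pack (range1 i) pu pack-t′)
                                                    (compose-leftFactor-pack (IH .outer) pb′ (sym (IH .compose-outer))) ⟩
    t ++ d                          ≡⟨ List.take++drop≡id (length u) w ⟩
    w                               ∎
    where open ≡-Reasoning
  len : length (s₁ ++ s₂) ≡ maxW (u •ᵂ b′)
  len = trans (List.length-++ s₁) (trans (cong₂ _+_ (length-leftFactor u t) (length-leftFactor b′ d)) (sym (maxW-• u b′)))
  ps : Packed (s₁ ++ s₂)
  ps = Packed-resp (compose-⊆ (s₁ ++ s₂) pb len) (⊆-compose (s₁ ++ s₂) pb len) (subst Packed (sym comp) pw)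
  len₁ : length s₁ ≡ length (range1 i)
  len₁ = trans (length-leftFactor u t) (sym (length-range1 i))
  pack-take-s : pack (take (length (range1 i)) (s₁ ++ s₂)) ≡ range1 i
  pack-take-s = trans (cong pack (take-++ s₁ s₂ len₁))
                      (pack-leftFactor pu (length-range1 i) pack-t′)
  pack-drop-s : pack (drop (length (range1 i)) (s₁ ++ s₂)) ≡ IH .outer
  pack-drop-s = trans (cong pack (drop-++ s₁ s₂ len₁))
                      (pack-leftFactor pb′ (IH .length-outer) (sym (IH .compose-outer)))

factors-bullet : ∀ {us} → All Packed us → ∀ w →
                 Factors us w ⇔ (w ≡ compose (leftFactor (bulletList us) w) (bulletList us) ×
                                 Factors (standards us) (leftFactor (bulletList us) w))
factors-bullet {us} pus w = mk⇔ ⇒ ⇐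
  where
  b = bulletList us
  g = leftFactor b w
  ⇒ : Factors us w → w ≡ compose g b × Factors (standards us) g
  ⇒ f = sym (trans (cong (λ s → compose s b) g≡outer) (D .compose-outer))
      , subst (Factors (standards us)) (sym g≡outer) (D .factors-outer)
    where
    D = factors-decompose pus f
    g≡outer : g ≡ D .outer
    g≡outer = trans (cong (leftFactor b) (sym (D .compose-outer))) (leftFactor-compose (Packed-bullet pus) (D .length-outer))
  ⇐ : w ≡ compose g b × Factors (standards us) g → Factors us w
  ⇐ (w≡gb , f) = subst (Factors us) (sym w≡gb) (factors-compose pus (length-leftFactor b w) f)

factorsᵇ-bullet : ∀ {us} → All Packed us → ∀ w → let b = bulletList us ; g = leftFactor b w in
                  factorsᵇ us w ≡ ((w =ᵂ compose g b) ∧ factorsᵇ (standards us) g)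
factorsᵇ-bullet {us} pus w = T-ext
  (λ h → let w≡gb , f = to (factors-bullet pus w) (to (factorsᵇ⇔Factors us) h)
         in from T-∧ (from =ᵂ⇔≡ w≡gb , from (factorsᵇ⇔Factors (standards us)) f))
  (λ h → let w=gb , f = to T-∧ h
         in from (factorsᵇ⇔Factors us) (from (factors-bullet pus w) (to =ᵂ⇔≡ w=gb , to (factorsᵇ⇔Factors (standards us)) f)))

Shat-standards : ∀ us → Shat (map maxW us) ≡ prodList (map M (standards us))
Shat-standards us = cong prodList (trans (sym (List.map-∘ us)) (List.map-∘ us))

mainTheorem3 : (us : List Word) → All IsPacked us →
    prodList (map M us) ≈ (M (bulletList us) * Shat (map maxW us))
mainTheorem3 us packed w = begin
  coeff w (prodList (map M us))                          ≡⟨ coeff-prodList us w ⟩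
  χ (factorsᵇ us w)                                      ≡⟨ cong χ (factorsᵇ-bullet pus w) ⟩
  χ (w=gb ∧ factorsᵇ rs g)                               ≡⟨ χ-∧ w=gb _ ⟩
  χ w=gb *ℕ χ (factorsᵇ rs g)                            ≡⟨ cong (χ w=gb *ℕ_) (coeff-prodList rs g) ⟨
  χ w=gb *ℕ coeff g (prodList (map M rs))                ≡⟨ cong (λ S → χ w=gb *ℕ coeff g S) (Shat-standards us) ⟨
  χ w=gb *ℕ coeff g (Shat (map maxW us))                 ≡⟨ coeff-M* (Packed-bullet pus) w (Shat (map maxW us)) ⟨
  coeff w (M b * Shat (map maxW us))                     ∎
  where
  open ≡-Reasoning
  pus = All.map (to isPackedᵇ⇔Packed) packed
  b = bulletList us
  g = leftFactor b w
  rs = standards us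
  w=gb = w =ᵂ compose g b
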